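{- For every integer $n\ge0$, the number of compositions of $n+1$ with exactly one even part equals the total number of parts in all compositions of $n$ all of whose parts are odd.
   Context: A composition of $n$ is a finite sequence of positive integers summing to $n$; its entries are its parts. The empty sequence is the unique composition of $0$ and has no parts. -}

module Defs where

open import Data.Nat using (ℕ; zero; suc; _+_; _∸_; _%_)
open import Data.Nat.Properties using (_≟_)
open import Data.Bool using (Bool; true; false; not)
open import Data.List using (List; []; _∷_; map; concatMap; length; upTo)
open import Data.Nat.ListAction using (sum)
open import Relation.Nullary using (Dec; yes; no)

isEven : ℕ → Bool
isEven n with n % 2 ≟ 0
... | yes _ = true
... | no _  = false

isOdd : ℕ → Bool
isOdd n = not (isEven n)

-- The fuel f only guarantees termination; f ≥ n suffices.
compsFuel : ℕ → ℕ → List (List ℕ)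
compsFuel _       zero    = [] ∷ []
compsFuel zero    (suc n) = []
compsFuel (suc f) (suc n) =
  concatMap (λ i → map (λ c → suc i ∷ c) (compsFuel f (n ∸ i))) (upTo (suc n))

-- The list of all compositions of n (each exactly once); the empty sequence is
-- the unique composition of 0.
compositions : ℕ → List (List ℕ)
compositions n = compsFuel n n

evenParts : List ℕ → ℕ
evenParts []      = 0
evenParts (x ∷ c) with isEven x
... | true  = suc (evenParts c)
... | false = evenParts c

allOdd : List ℕ → Bool
allOdd []      = true
allOdd (x ∷ c) with isOdd x
... | true  = allOdd c
... | false = false

hasExactlyOneEvenPart : List ℕ → Bool
hasExactlyOneEvenPart c with evenParts c ≟ 1
... | yes _ = true
... | no _  = false

filterB : {A : Set} → (A → Bool) → List A → List A
filterB p []      = []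
filterB p (x ∷ xs) with p x
... | true  = x ∷ filterB p xs
... | false = filterB p xs

numOneEven : ℕ → ℕ
numOneEven n = length (filterB hasExactlyOneEvenPart (compositions n))

totalPartsAllOdd : ℕ → ℕ
totalPartsAllOdd n = sum (map length (filterB allOdd (compositions n)))

module Submission where

-- Compositions of n+1 with exactly one even part are equinumerous with
-- all-odd compositions of n carrying one marked part (add 1 to the marked
-- part).
--
-- 1. Every composition of n+2 arises exactly once from a composition of
--    n+1 either by prepending a new part 1 or by adding 1 to the first part.
-- 2. The statistics we count (number of even parts, all parts odd, number of
--    parts) only depend on the *profile* of a composition h ∷ t: whether h
--    is even, how many even parts t has, and the length of t.  The two
--    operations of step 1 act on profiles, so every such sum over the
--    compositions of n+1 equals a sum over an explicitly generated list of
--    profiles (lemma transfer).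
-- 3. Write O(n) for the number of compositions of n+1 with exactly one even
--    part and L(n) for the total number of parts of all-odd compositions
--    of n+1.  On profiles, O and L satisfy coupled linear recurrences
--    (together with the number of all-odd compositions and two "bumped"
--    variants), and a simultaneous induction gives O(n+1) = L(n).

open import Defs
open import Data.Nat using (ℕ; zero; suc; _+_; _∸_; _%_; _≤_; s≤s; _≡ᵇ_)
open import Data.Nat.Properties
  using (_≟_; ≡ᵇ⇒≡; +-comm; +-assoc; ≤-trans; m∸n≤m; n≤1+n; +-commutativeSemigroup)
open import Algebra.Properties.CommutativeSemigroup +-commutativeSemigroup
  using (interchange)
open import Data.Bool using (Bool; true; false; not; if_then_else_; T)
open import Data.Unit using (tt)
open import Data.Bool.Properties using (not-involutive)
open import Data.List using (List; []; _∷_; map; concatMap; length; upTo; applyUpTo; _++_)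
open import Data.List.Properties
  using (map-++; map-∘; map-cong; concatMap-cong; concatMap-map; map-concatMap; map-applyUpTo)
open import Data.Nat.ListAction using (sum)
open import Data.Nat.ListAction.Properties using (sum-++)
open import Data.Product using (_×_; _,_; proj₁)
open import Data.Empty using (⊥-elim)
open import Relation.Nullary using (yes; no)
open import Relation.Binary.PropositionalEquality
  using (_≡_; _≢_; refl; sym; subst; trans; cong; cong₂; module ≡-Reasoning)
open import Function using (_∘_)

fuel-irrelevant : ∀ {f g m} → m ≤ f → m ≤ g → compsFuel f m ≡ compsFuel g m
fuel-irrelevant {m = zero} _ _ = refl
fuel-irrelevant {suc f} {suc g} {suc m} (s≤s m≤f) (s≤s m≤g) =
  concatMap-cong
    (λ i → cong (map (suc i ∷_))
      (fuel-irrelevant (≤-trans (m∸n≤m m i) m≤f) (≤-trans (m∸n≤m m i) m≤g)))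
    (upTo (suc m))

bumpFirst : List ℕ → List ℕ
bumpFirst []      = []
bumpFirst (h ∷ t) = suc h ∷ t

compositions-suc-suc : ∀ n → compositions (suc (suc n)) ≡
  map (1 ∷_) (compositions (suc n)) ++ map bumpFirst (compositions (suc n))
compositions-suc-suc n = cong (map (1 ∷_) (compositions (suc n)) ++_) (begin
    concatMap (λ i → map (suc i ∷_) (compsFuel (suc n) (suc n ∸ i))) (applyUpTo suc (suc n))
  ≡⟨ cong (concatMap _) (sym (map-applyUpTo (λ i → i) suc (suc n))) ⟩
    concatMap (λ i → map (suc i ∷_) (compsFuel (suc n) (suc n ∸ i))) (map suc (upTo (suc n)))
  ≡⟨ concatMap-map _ suc (upTo (suc n)) ⟩
    concatMap (λ i → map (suc (suc i) ∷_) (compsFuel (suc n) (n ∸ i))) (upTo (suc n))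
  ≡⟨ concatMap-cong bumped (upTo (suc n)) ⟩
    concatMap (λ i → map bumpFirst (map (suc i ∷_) (compsFuel n (n ∸ i)))) (upTo (suc n))
  ≡⟨ sym (map-concatMap bumpFirst _ (upTo (suc n))) ⟩
    map bumpFirst (compositions (suc n)) ∎)
  where
  open ≡-Reasoning
  bumped : ∀ i → map (suc (suc i) ∷_) (compsFuel (suc n) (n ∸ i))
               ≡ map bumpFirst (map (suc i ∷_) (compsFuel n (n ∸ i)))
  bumped i = trans
    (cong (map (suc (suc i) ∷_))
      (fuel-irrelevant (≤-trans (m∸n≤m n i) (n≤1+n n)) (m∸n≤m n i)))
    (map-∘ (compsFuel n (n ∸ i)))

sumOf : {A : Set} → (A → ℕ) → List A → ℕ
sumOf w xs = sum (map w xs)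

module _ {A : Set} where

  sumOf-++ : (w : A → ℕ) (xs ys : List A) → sumOf w (xs ++ ys) ≡ sumOf w xs + sumOf w ys
  sumOf-++ w xs ys = trans (cong sum (map-++ w xs ys)) (sum-++ (map w xs) (map w ys))

  sumOf-cong : {v w : A → ℕ} → (∀ x → v x ≡ w x) → (xs : List A) → sumOf v xs ≡ sumOf w xs
  sumOf-cong v≗w xs = cong sum (map-cong v≗w xs)

  sumOf-+ : (v w : A → ℕ) (xs : List A) → sumOf (λ x → v x + w x) xs ≡ sumOf v xs + sumOf w xs
  sumOf-+ v w []       = refl
  sumOf-+ v w (x ∷ xs) =
    trans (cong (v x + w x +_) (sumOf-+ v w xs)) (interchange (v x) (w x) (sumOf v xs) (sumOf w xs))

  sumOf-zero : (xs : List A) → sumOf (λ _ → 0) xs ≡ 0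
  sumOf-zero []       = refl
  sumOf-zero (_ ∷ xs) = sumOf-zero xs

  length≡sumOf-one : (xs : List A) → length xs ≡ sumOf (λ _ → 1) xs
  length≡sumOf-one []       = refl
  length≡sumOf-one (_ ∷ xs) = cong suc (length≡sumOf-one xs)

  sumOf-filterB : (w : A → ℕ) (p : A → Bool) (xs : List A) →
    sumOf w (filterB p xs) ≡ sumOf (λ x → if p x then w x else 0) xs
  sumOf-filterB w p []       = refl
  sumOf-filterB w p (x ∷ xs) with p x
  ... | true  = cong (w x +_) (sumOf-filterB w p xs)
  ... | false = sumOf-filterB w p xs

sumOf-split : {A B : Set} (w : B → ℕ) (f g : A → B) (xs : List A) →
  sumOf w (map f xs ++ map g xs) ≡ sumOf (w ∘ f) xs + sumOf (w ∘ g) xs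
sumOf-split w f g xs = trans (sumOf-++ w (map f xs) (map g xs))
  (cong₂ _+_ (cong sum (sym (map-∘ xs))) (cong sum (sym (map-∘ xs))))

isEven-cong : ∀ {m n} → m % 2 ≡ n % 2 → isEven m ≡ isEven n
isEven-cong {m} {n} m≡n with m % 2 ≟ 0 | n % 2 ≟ 0
... | yes _   | yes _   = refl
... | no _    | no _    = refl
... | yes m≡0 | no n≢0  = ⊥-elim (n≢0 (trans (sym m≡n) m≡0))
... | no m≢0  | yes n≡0 = ⊥-elim (m≢0 (trans m≡n n≡0))

isEven-suc : ∀ n → isEven (suc n) ≡ not (isEven n)
isEven-suc zero          = refl
isEven-suc (suc zero)    = refl
isEven-suc (suc (suc n)) = begin
  isEven (suc (suc (suc n))) ≡⟨ isEven-cong refl ⟩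
  isEven (suc n)             ≡⟨ isEven-suc n ⟩
  not (isEven n)             ≡⟨ cong not (isEven-cong refl) ⟩
  not (isEven (suc (suc n))) ∎
  where open ≡-Reasoning

hasExactlyOneEvenPart≡ᵇ : ∀ c → hasExactlyOneEvenPart c ≡ (evenParts c ≡ᵇ 1)
hasExactlyOneEvenPart≡ᵇ c with evenParts c ≟ 1
... | yes one  = cong (_≡ᵇ 1) (sym one)
... | no ¬one  = sym (≢⇒≡ᵇ-false ¬one)
  where
  ≢⇒≡ᵇ-false : ∀ {m n} → m ≢ n → (m ≡ᵇ n) ≡ false
  ≢⇒≡ᵇ-false {m} {n} m≢n with m ≡ᵇ n in eq
  ... | true  = ⊥-elim (m≢n (≡ᵇ⇒≡ m n (subst T (sym eq) tt)))
  ... | false = refl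

allOdd≡ᵇ : ∀ c → allOdd c ≡ (evenParts c ≡ᵇ 0)
allOdd≡ᵇ []      = refl
allOdd≡ᵇ (x ∷ c) with isEven x
... | true  = refl
... | false = allOdd≡ᵇ c

record Profile : Set where
  constructor profile
  field
    headEven   : Bool
    tailEvens  : ℕ
    tailLength : ℕ
open Profile

profileOf : ℕ → List ℕ → Profile
profileOf h t = profile (isEven h) (evenParts t) (length t)

totalEvens : Profile → ℕ
totalEvens p = if headEven p then suc (tailEvens p) else tailEvens p

evenParts-cons : ∀ h t → evenParts (h ∷ t) ≡ totalEvens (profileOf h t)
evenParts-cons h t with isEven h
... | true  = refl
... | false = refl

-- Effect on profiles of prepending a part 1 and of bumping the first part.
newPart : Profile → Profile
newPart p = profile false (totalEvens p) (suc (tailLength p))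

bumpHead : Profile → Profile
bumpHead p = profile (not (headEven p)) (tailEvens p) (tailLength p)

bumpHead-involutive : ∀ p → bumpHead (bumpHead p) ≡ p
bumpHead-involutive (profile e k l) = cong (λ b → profile b k l) (not-involutive e)

-- The profiles of the compositions of n+1, with multiplicity.
profiles : ℕ → List Profile
profiles zero    = profile false 0 0 ∷ []
profiles (suc n) = map newPart (profiles n) ++ map bumpHead (profiles n)

transfer : (w : List ℕ → ℕ) (s : Profile → ℕ) → (∀ h t → w (h ∷ t) ≡ s (profileOf h t)) →
  ∀ n → sumOf w (compositions (suc n)) ≡ sumOf s (profiles n)
transfer w s w≗s zero    = cong (_+ 0) (w≗s 1 [])
transfer w s w≗s (suc n) = begin
    sumOf w (compositions (suc (suc n)))
  ≡⟨ cong (sumOf w) (compositions-suc-suc n) ⟩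
    sumOf w (map (1 ∷_) (compositions (suc n)) ++ map bumpFirst (compositions (suc n)))
  ≡⟨ sumOf-split w (1 ∷_) bumpFirst (compositions (suc n)) ⟩
    sumOf (w ∘ (1 ∷_)) (compositions (suc n)) + sumOf (w ∘ bumpFirst) (compositions (suc n))
  ≡⟨ cong₂ _+_ (transfer _ (s ∘ newPart) prepended n) (transfer _ (s ∘ bumpHead) bumped n) ⟩
    sumOf (s ∘ newPart) (profiles n) + sumOf (s ∘ bumpHead) (profiles n)
  ≡⟨ sym (sumOf-split s newPart bumpHead (profiles n)) ⟩
    sumOf s (profiles (suc n)) ∎
  where
  open ≡-Reasoning
  prepended : ∀ h t → w (1 ∷ h ∷ t) ≡ s (newPart (profileOf h t))
  prepended h t = trans (w≗s 1 (h ∷ t))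
    (cong (λ k → s (profile false k (suc (length t)))) (evenParts-cons h t))
  bumped : ∀ h t → w (suc h ∷ t) ≡ s (bumpHead (profileOf h t))
  bumped h t = trans (w≗s (suc h) t)
    (cong (λ b → s (profile b (evenParts t) (length t))) (isEven-suc h))

total : (Profile → ℕ) → ℕ → ℕ
total s n = sumOf s (profiles n)

total-suc : ∀ s n → total s (suc n) ≡ total (s ∘ newPart) n + total (s ∘ bumpHead) n
total-suc s n = sumOf-split s newPart bumpHead (profiles n)

oneEven : Profile → ℕ
oneEven p = if totalEvens p ≡ᵇ 1 then 1 else 0

allOddCount : Profile → ℕ
allOddCount p = if totalEvens p ≡ᵇ 0 then 1 else 0

allOddParts : Profile → ℕ
allOddParts p = if totalEvens p ≡ᵇ 0 then suc (tailLength p) else 0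

allOddParts-newPart : ∀ p → allOddParts (newPart p) ≡ allOddParts p + allOddCount p
allOddParts-newPart p with totalEvens p ≡ᵇ 0
... | true  = cong suc (+-comm 1 (tailLength p))
... | false = refl

-- The coupled recurrences, with O = total oneEven, L = total allOddParts,
-- a = total allOddCount, and X, Lb the same statistics read after bumping
-- the head:
--   O(n+1) = O(n) + X(n)          (prepending 1 keeps the even parts)
--   X(n+1) = a(n) + O(n)          (bumping a new head 1 makes the only even part)
--   L(n+1) = L(n) + a(n) + Lb(n)  (allOddParts-newPart)
--   Lb(n+1) = L(n)                (a bumped new head 1 is even)
-- The second and fourth use that bumping twice changes nothing.
oneEven-suc : ∀ n → total oneEven (suc n) ≡ total oneEven n + total (oneEven ∘ bumpHead) n
oneEven-suc = total-suc oneEven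

oneEvenBumped-suc : ∀ n →
  total (oneEven ∘ bumpHead) (suc n) ≡ total allOddCount n + total oneEven n
oneEvenBumped-suc n = trans (total-suc (oneEven ∘ bumpHead) n)
  (cong (total allOddCount n +_)
    (sumOf-cong (λ p → cong oneEven (bumpHead-involutive p)) (profiles n)))

allOddParts-suc : ∀ n → total allOddParts (suc n) ≡
  (total allOddParts n + total allOddCount n) + total (allOddParts ∘ bumpHead) n
allOddParts-suc n = trans (total-suc allOddParts n)
  (cong (_+ total (allOddParts ∘ bumpHead) n)
    (trans (sumOf-cong allOddParts-newPart (profiles n))
           (sumOf-+ allOddParts allOddCount (profiles n))))

allOddPartsBumped-suc : ∀ n → total (allOddParts ∘ bumpHead) (suc n) ≡ total allOddParts n
allOddPartsBumped-suc n = trans (total-suc (allOddParts ∘ bumpHead) n)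
  (cong₂ _+_ (sumOf-zero (profiles n))
    (sumOf-cong (λ p → cong allOddParts (bumpHead-involutive p)) (profiles n)))

-- Simultaneous induction: O(n+1) = L(n) and O(n) = Lb(n).  The second
-- component is the one-step-delayed copy of the first that the
-- second-order recurrence for O needs.
one-even≡all-odd-parts : ∀ n →
  total oneEven (suc n) ≡ total allOddParts n × total oneEven n ≡ total (allOddParts ∘ bumpHead) n
one-even≡all-odd-parts zero    = refl , refl
one-even≡all-odd-parts (suc n) with one-even≡all-odd-parts n
... | next , now = step , trans next (sym (allOddPartsBumped-suc n))
  where
  open ≡-Reasoning
  O = total oneEven
  L = total allOddParts
  a = total allOddCount
  step : O (suc (suc n)) ≡ L (suc n)
  step = begin
      O (suc (suc n))
    ≡⟨ oneEven-suc (suc n) ⟩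
      O (suc n) + total (oneEven ∘ bumpHead) (suc n)
    ≡⟨ cong₂ _+_ next (oneEvenBumped-suc n) ⟩
      L n + (a n + O n)
    ≡⟨ cong (λ k → L n + (a n + k)) now ⟩
      L n + (a n + total (allOddParts ∘ bumpHead) n)
    ≡⟨ sym (+-assoc (L n) (a n) _) ⟩
      (L n + a n) + total (allOddParts ∘ bumpHead) n
    ≡⟨ sym (allOddParts-suc n) ⟩
      L (suc n) ∎

numOneEven≡total : ∀ n → numOneEven (suc n) ≡ total oneEven n
numOneEven≡total n = begin
    length (filterB hasExactlyOneEvenPart (compositions (suc n)))
  ≡⟨ length≡sumOf-one (filterB hasExactlyOneEvenPart (compositions (suc n))) ⟩
    sumOf (λ _ → 1) (filterB hasExactlyOneEvenPart (compositions (suc n)))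
  ≡⟨ sumOf-filterB (λ _ → 1) hasExactlyOneEvenPart (compositions (suc n)) ⟩
    sumOf (λ c → if hasExactlyOneEvenPart c then 1 else 0) (compositions (suc n))
  ≡⟨ transfer _ oneEven counts n ⟩
    total oneEven n ∎
  where
  open ≡-Reasoning
  counts : ∀ h t → (if hasExactlyOneEvenPart (h ∷ t) then 1 else 0) ≡ oneEven (profileOf h t)
  counts h t = cong (λ b → if b then 1 else 0)
    (trans (hasExactlyOneEvenPart≡ᵇ (h ∷ t)) (cong (_≡ᵇ 1) (evenParts-cons h t)))

totalPartsAllOdd≡total : ∀ n → totalPartsAllOdd (suc n) ≡ total allOddParts n
totalPartsAllOdd≡total n = begin
    sumOf length (filterB allOdd (compositions (suc n)))
  ≡⟨ sumOf-filterB length allOdd (compositions (suc n)) ⟩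
    sumOf (λ c → if allOdd c then length c else 0) (compositions (suc n))
  ≡⟨ transfer _ allOddParts counts n ⟩
    total allOddParts n ∎
  where
  open ≡-Reasoning
  counts : ∀ h t → (if allOdd (h ∷ t) then suc (length t) else 0) ≡ allOddParts (profileOf h t)
  counts h t = cong (λ b → if b then suc (length t) else 0)
    (trans (allOdd≡ᵇ (h ∷ t)) (cong (_≡ᵇ 0) (evenParts-cons h t)))

corollary6p2 : (n : ℕ) → numOneEven (suc n) ≡ totalPartsAllOdd n
corollary6p2 zero    = refl
corollary6p2 (suc n) = begin
  numOneEven (suc (suc n))  ≡⟨ numOneEven≡total (suc n) ⟩
  total oneEven (suc n)     ≡⟨ proj₁ (one-even≡all-odd-parts n) ⟩
  total allOddParts n       ≡⟨ sym (totalPartsAllOdd≡total n) ⟩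
  totalPartsAllOdd (suc n)  ∎
  where open ≡-Reasoning
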